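{- Let the polynomials $p_k(y)$, $k\ge1$, be defined by $p_1(y)=2y-3$ and $p_{k+1}(y)=4y\,p_k'(y)+(5-4y)\,p_k(y)$, and write $p_k(y)=\sum_{j=0}^{k}d(j,k)y^j$. For $k\in\{5,9\}$ define integers $s_k(i,j)$ for integers $i,j$ by: $s_k(i,j)=0$ if $i\le0$ and $j\ge1$; $s_k(i,j)=0$ if $j<0$ and $i\ge1$; $s_k(i,0)=1$ for $i\ge1$; $s_k(1,j)=k^j$ for $j\ge1$; and $s_k(i+1,j)=s_k(i,j)+s_k(i+1,j-1)(k+4i)$ for $i,j\ge1$. Then for all integers $i,j\ge0$ with $i+j\ge1$, $$d(i,i+j)=-3\,(-4)^i\,s_5(i+1,j-1)+2\,(-4)^{i-1}\,s_9(i,j).$$ -}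

module Defs where

open import Data.Nat as ℕ using (ℕ; zero; suc)
open import Data.Integer using (ℤ; +_; -_; _+_; _-_; _*_; _^_)

-- Polynomials over ℤ represented by their coefficient sequence:
-- a polynomial f(y) = Σ_j f j · y^j  (finitely supported in practice).
Poly : Set
Poly = ℕ → ℤ

deriv : Poly → Poly
deriv f j = + (suc j) * f (suc j)

mulY : Poly → Poly
mulY f zero    = + 0
mulY f (suc j) = f j

p₁ : Poly
p₁ zero          = - (+ 3)
p₁ (suc zero)    = + 2
p₁ (suc (suc _)) = + 0

next : Poly → Poly
next f j = + 4 * mulY (deriv f) j + (+ 5 * f j - + 4 * mulY f j)

-- p k = p_k for k ≥ 1 (p 0 is an unused dummy, the zero polynomial)
p : ℕ → Poly
p zero                = λ _ → + 0
p (suc zero)          = p₁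
p (suc k@(suc _))     = next (p k)

d : ℕ → ℕ → ℤ
d j k = p k j

-- s k i j = s_k(i,j) for natural i, j.
--   s_k(i,j) = 0 for i ≤ 0, j ≥ 1   (the value s_k(0,0) is not specified
--                                      by the paper and is never used; set to 0)
--   s_k(i,0) = 1 for i ≥ 1
--   s_k(1,j) = k^j for j ≥ 1
--   s_k(i+1,j) = s_k(i,j) + s_k(i+1,j-1)(k+4i) for i,j ≥ 1
s : ℕ → ℕ → ℕ → ℤ
s k zero          j       = + 0
s k (suc i)       zero    = + 1
s k (suc zero)    (suc j) = (+ k) ^ (suc j)
s k (suc (suc i)) (suc j) =
  s k (suc i) (suc j) + s k (suc (suc i)) j * (+ k + + 4 * + (suc i))

-- sPrev k i j = s_k(i, j-1) for i ≥ 1; when j = 0 this is s_k(i,-1) = 0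
-- (paper: s_k(i,j) = 0 for j < 0, i ≥ 1).
sPrev : ℕ → ℕ → ℕ → ℤ
sPrev k i zero    = + 0
sPrev k i (suc j) = s k i j

-- second term 2 (-4)^(i-1) s_9(i,j).  For i = 0 (then j ≥ 1) the factor
-- s_9(0,j) = 0, so the whole term is 0.
term₂ : ℕ → ℕ → ℤ
term₂ zero    j = + 0
term₂ (suc i) j = + 2 * (- (+ 4)) ^ i * s 9 (suc i) j

-- Write D(i,j) = d(i,i+j).  Comparing coefficients in p_{k+1} = 4y p_k' + (5-4y) p_k
-- gives D(i+1,j+1) = (9+4i) D(i+1,j) - 4 D(i,j+1).  The recurrence of s_k, extended to
-- i = 0 by s_k(0,j) = 0, is s_k(i+1,j+1) = s_k(i,j+1) + (k+4i) s_k(i+1,j), and the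
-- weight (-4)^i turns it into the recurrence of D; for the term with s_5 the index is
-- shifted by one, and 5 + 4(i+1) = 9 + 4i.  Such a recurrence determines its solution
-- from the boundary lines j = 0 (leading coefficients, as deg p_k = k) and i = 0
-- (constant terms), where both sides are computed directly.
module Submission where

open import Defs
open import Data.Nat using (ℕ; zero; suc; _≤_; _<_; s≤s) renaming (_+_ to _+ℕ_)
open import Data.Nat.Properties using (≤-refl; +-suc; +-identityʳ; m<n⇒m<1+n)
open import Data.Integer using (ℤ; +_; -_; _+_; _-_; _*_; _^_)
open import Data.Integer.Tactic.RingSolver using (solve-∀)
open import Relation.Binary.PropositionalEquality using (_≡_; refl; sym; cong; cong₂)
open Relation.Binary.PropositionalEquality.≡-Reasoning

next-zero : ∀ f → next f 0 ≡ + 5 * f 0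
next-zero f = lemma (f 0)
  where
  lemma : ∀ x → + 4 * + 0 + (+ 5 * x - + 4 * + 0) ≡ + 5 * x
  lemma = solve-∀

next-suc : ∀ f i → next f (suc i) ≡ (+ 9 + + 4 * + i) * f (suc i) - + 4 * f i
next-suc f i = lemma (+ i) (f (suc i)) (f i)
  where
  lemma : ∀ c x y → + 4 * ((+ 1 + c) * x) + (+ 5 * x - + 4 * y) ≡ (+ 9 + + 4 * c) * x - + 4 * y
  lemma = solve-∀

p-degree : ∀ k {i} → suc k < i → p (suc k) i ≡ + 0
p-degree zero    (s≤s (s≤s _)) = refl
p-degree (suc k) {suc i} (s≤s k+1<i) = begin
  next (p (suc k)) (suc i)                                  ≡⟨ next-suc (p (suc k)) i ⟩
  (+ 9 + + 4 * + i) * p (suc k) (suc i) - + 4 * p (suc k) i ≡⟨ cong₂ (λ x y → (+ 9 + + 4 * + i) * x - + 4 * y)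
                                                                       (p-degree k (m<n⇒m<1+n k+1<i)) (p-degree k k+1<i) ⟩
  (+ 9 + + 4 * + i) * + 0 - + 4 * + 0                        ≡⟨ lemma (+ i) ⟩
  + 0                                                       ∎
  where
  lemma : ∀ c → (+ 9 + + 4 * c) * + 0 - + 4 * + 0 ≡ + 0
  lemma = solve-∀

p-leading : ∀ k → p (suc k) (suc k) ≡ + 2 * (- (+ 4)) ^ k
p-leading zero    = refl
p-leading (suc k) = begin
  next (p (suc k)) (suc (suc k))                                          ≡⟨ next-suc (p (suc k)) (suc k) ⟩
  (+ 9 + + 4 * + suc k) * p (suc k) (suc (suc k)) - + 4 * p (suc k) (suc k)
    ≡⟨ cong₂ (λ x y → (+ 9 + + 4 * + suc k) * x - + 4 * y) (p-degree k (s≤s ≤-refl)) (p-leading k) ⟩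
  (+ 9 + + 4 * + suc k) * + 0 - + 4 * (+ 2 * (- (+ 4)) ^ k)             ≡⟨ lemma (+ suc k) ((- (+ 4)) ^ k) ⟩
  + 2 * (- (+ 4)) ^ suc k                                                 ∎
  where
  lemma : ∀ c a → (+ 9 + + 4 * c) * + 0 - + 4 * (+ 2 * a) ≡ + 2 * (- (+ 4) * a)
  lemma = solve-∀

p-constant-term : ∀ k → p (suc k) 0 ≡ - (+ 3) * (+ 5) ^ k
p-constant-term zero    = refl
p-constant-term (suc k) = begin
  next (p (suc k)) 0          ≡⟨ next-zero (p (suc k)) ⟩
  + 5 * p (suc k) 0           ≡⟨ cong (+ 5 *_) (p-constant-term k) ⟩
  + 5 * (- (+ 3) * (+ 5) ^ k) ≡⟨ lemma ((+ 5) ^ k) ⟩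
  - (+ 3) * (+ 5) ^ suc k     ∎
  where
  lemma : ∀ a → + 5 * (- (+ 3) * a) ≡ - (+ 3) * (+ 5 * a)
  lemma = solve-∀

s-first-row : ∀ k j → s k 1 j ≡ (+ k) ^ j
s-first-row k zero    = refl
s-first-row k (suc j) = refl

s-pascal : ∀ k i j → s k (suc i) (suc j) ≡ s k i (suc j) + s k (suc i) j * (+ k + + 4 * + i)
s-pascal k zero    j = begin
  + k * (+ k) ^ j                      ≡⟨ lemma (+ k) ((+ k) ^ j) ⟩
  + 0 + (+ k) ^ j * (+ k + + 4 * + 0)  ≡⟨ cong (λ x → + 0 + x * (+ k + + 4 * + 0)) (sym (s-first-row k j)) ⟩
  + 0 + s k 1 j * (+ k + + 4 * + 0)    ∎
  where
  lemma : ∀ c x → c * x ≡ + 0 + x * (c + + 4 * + 0)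
  lemma = solve-∀
s-pascal k (suc i) j = refl

sPrev-pascal : ∀ k i j → sPrev k (suc (suc i)) (suc j)
             ≡ sPrev k (suc i) (suc j) + sPrev k (suc (suc i)) j * (+ k + + 4 * + suc i)
sPrev-pascal k i zero    = lemma (+ k + + 4 * + suc i)
  where
  lemma : ∀ c → + 1 ≡ + 1 + + 0 * c
  lemma = solve-∀
sPrev-pascal k i (suc j) = s-pascal k (suc i) j

Recurrence : (ℕ → ℕ → ℤ) → Set
Recurrence T = ∀ i j → T (suc i) (suc j) ≡ (+ 9 + + 4 * + i) * T (suc i) j - + 4 * T i (suc j)

recurrence-+ : ∀ {T U} → Recurrence T → Recurrence U → Recurrence (λ i j → T i j + U i j)
recurrence-+ {T} {U} recT recU i j = begin
  T (suc i) (suc j) + U (suc i) (suc j)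
    ≡⟨ cong₂ _+_ (recT i j) (recU i j) ⟩
  ((+ 9 + + 4 * + i) * T (suc i) j - + 4 * T i (suc j)) + ((+ 9 + + 4 * + i) * U (suc i) j - + 4 * U i (suc j))
    ≡⟨ lemma (+ 9 + + 4 * + i) (T (suc i) j) (T i (suc j)) (U (suc i) j) (U i (suc j)) ⟩
  (+ 9 + + 4 * + i) * (T (suc i) j + U (suc i) j) - + 4 * (T i (suc j) + U i (suc j))
    ∎
  where
  lemma : ∀ c t₁ t₀ u₁ u₀ → (c * t₁ - + 4 * t₀) + (c * u₁ - + 4 * u₀) ≡ c * (t₁ + u₁) - + 4 * (t₀ + u₀)
  lemma = solve-∀

recurrence-unique : ∀ {T U} → Recurrence T → Recurrence U →
                    (∀ j → T 0 j ≡ U 0 j) → (∀ i → T i 0 ≡ U i 0) → ∀ i j → T i j ≡ U i j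
recurrence-unique {T} {U} recT recU row column = go
  where
  go : ∀ i j → T i j ≡ U i j
  go zero    j       = row j
  go (suc i) zero    = column (suc i)
  go (suc i) (suc j) = begin
    T (suc i) (suc j)                                   ≡⟨ recT i j ⟩
    (+ 9 + + 4 * + i) * T (suc i) j - + 4 * T i (suc j) ≡⟨ cong₂ (λ x y → (+ 9 + + 4 * + i) * x - + 4 * y)
                                                                 (go (suc i) j) (go i (suc j)) ⟩
    (+ 9 + + 4 * + i) * U (suc i) j - + 4 * U i (suc j) ≡⟨ sym (recU i j) ⟩
    U (suc i) (suc j)                                   ∎

d′ : ℕ → ℕ → ℤ
d′ i j = d i (i +ℕ j)

d′-recurrence : Recurrence d′
d′-recurrence i j = begin
  p (suc (i +ℕ suc j)) (suc i)                        ≡⟨ cong (λ m → p (suc m) (suc i)) (+-suc i j) ⟩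
  next (p (suc n)) (suc i)                            ≡⟨ next-suc (p (suc n)) i ⟩
  (+ 9 + + 4 * + i) * p (suc n) (suc i) - + 4 * p (suc n) i
    ≡⟨ cong (λ m → (+ 9 + + 4 * + i) * p (suc n) (suc i) - + 4 * p m i) (sym (+-suc i j)) ⟩
  (+ 9 + + 4 * + i) * p (suc n) (suc i) - + 4 * p (i +ℕ suc j) i ∎
  where
  n : ℕ
  n = i +ℕ j

term₁ : ℕ → ℕ → ℤ
term₁ i j = - (+ 3) * (- (+ 4)) ^ i * sPrev 5 (suc i) j

term₁-recurrence : Recurrence term₁
term₁-recurrence i j = begin
  - (+ 3) * (- (+ 4) * a) * sPrev 5 (suc (suc i)) (suc j)
    ≡⟨ cong (- (+ 3) * (- (+ 4) * a) *_) (sPrev-pascal 5 i j) ⟩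
  - (+ 3) * (- (+ 4) * a) * (sPrev 5 (suc i) (suc j) + sPrev 5 (suc (suc i)) j * (+ 5 + + 4 * + suc i))
    ≡⟨ lemma a (+ i) (sPrev 5 (suc i) (suc j)) (sPrev 5 (suc (suc i)) j) ⟩
  (+ 9 + + 4 * + i) * (- (+ 3) * (- (+ 4) * a) * sPrev 5 (suc (suc i)) j) - + 4 * (- (+ 3) * a * sPrev 5 (suc i) (suc j))
    ∎
  where
  a : ℤ
  a = (- (+ 4)) ^ i
  lemma : ∀ a c y x → - (+ 3) * (- (+ 4) * a) * (y + x * (+ 5 + + 4 * (+ 1 + c)))
                    ≡ (+ 9 + + 4 * c) * (- (+ 3) * (- (+ 4) * a) * x) - + 4 * (- (+ 3) * a * y)
  lemma = solve-∀

term₂-shift : ∀ i j → + 2 * (- (+ 4)) ^ i * s 9 i j ≡ - (+ 4 * term₂ i j)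
term₂-shift zero    j = refl
term₂-shift (suc i) j = lemma ((- (+ 4)) ^ i) (s 9 (suc i) j)
  where
  lemma : ∀ a x → + 2 * (- (+ 4) * a) * x ≡ - (+ 4 * (+ 2 * a * x))
  lemma = solve-∀

term₂-recurrence : Recurrence term₂
term₂-recurrence i j = begin
  + 2 * a * s 9 (suc i) (suc j)
    ≡⟨ cong (+ 2 * a *_) (s-pascal 9 i j) ⟩
  + 2 * a * (s 9 i (suc j) + s 9 (suc i) j * (+ 9 + + 4 * + i))
    ≡⟨ lemma a (+ 9 + + 4 * + i) (s 9 i (suc j)) (s 9 (suc i) j) ⟩
  (+ 9 + + 4 * + i) * (+ 2 * a * s 9 (suc i) j) + + 2 * a * s 9 i (suc j)
    ≡⟨ cong (λ v → (+ 9 + + 4 * + i) * (+ 2 * a * s 9 (suc i) j) + v) (term₂-shift i (suc j)) ⟩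
  (+ 9 + + 4 * + i) * (+ 2 * a * s 9 (suc i) j) - + 4 * term₂ i (suc j)
    ∎
  where
  a : ℤ
  a = (- (+ 4)) ^ i
  lemma : ∀ a c u x → + 2 * a * (u + x * c) ≡ c * (+ 2 * a * x) + + 2 * a * u
  lemma = solve-∀

closedForm : ℕ → ℕ → ℤ
closedForm i j = term₁ i j + term₂ i j

closedForm-recurrence : Recurrence closedForm
closedForm-recurrence = recurrence-+ {term₁} {term₂} term₁-recurrence term₂-recurrence

d′-row : ∀ j → d′ 0 j ≡ closedForm 0 j
d′-row zero    = refl
d′-row (suc k) = begin
  p (suc k) 0                            ≡⟨ p-constant-term k ⟩
  - (+ 3) * (+ 5) ^ k                    ≡⟨ lemma ((+ 5) ^ k) ⟩
  - (+ 3) * + 1 * (+ 5) ^ k + + 0        ≡⟨ cong (λ x → - (+ 3) * + 1 * x + + 0) (sym (s-first-row 5 k)) ⟩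
  - (+ 3) * + 1 * s 5 1 k + + 0          ∎
  where
  lemma : ∀ x → - (+ 3) * x ≡ - (+ 3) * + 1 * x + + 0
  lemma = solve-∀

d′-column : ∀ i → d′ i 0 ≡ closedForm i 0
d′-column zero    = refl
d′-column (suc i) = begin
  p (suc (i +ℕ 0)) (suc i)   ≡⟨ cong (λ n → p (suc n) (suc i)) (+-identityʳ i) ⟩
  p (suc i) (suc i)          ≡⟨ p-leading i ⟩
  + 2 * (- (+ 4)) ^ i        ≡⟨ lemma ((- (+ 4)) ^ i) ⟩
  - (+ 3) * (- (+ 4) * (- (+ 4)) ^ i) * + 0 + + 2 * (- (+ 4)) ^ i * + 1 ∎
  where
  lemma : ∀ a → + 2 * a ≡ - (+ 3) * (- (+ 4) * a) * + 0 + + 2 * a * + 1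
  lemma = solve-∀

lemma6p4 : (i j : ℕ) → 1 ≤ i Data.Nat.+ j →
    d i (i Data.Nat.+ j) ≡ - (+ 3) * (- (+ 4)) ^ i * sPrev 5 (suc i) j + term₂ i j
-- The hypothesis is not needed: with the dummy p 0 = 0 of Defs both sides vanish at i = j = 0.
lemma6p4 i j _ =
  recurrence-unique {d′} {closedForm} d′-recurrence closedForm-recurrence d′-row d′-column i j
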